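{- Let $n$ be a positive integer and let $\mathcal{F}\subseteq 2^{[n]}$ be a family of subsets of $[n]=\{1,\dots,n\}$. Then there exists an element $i\in[n]$ such that at least half of the sets in $\mathcal{F}$ contain $i$ if and only if there exists a family $\mathcal{G}\subseteq 2^{[n]}$ with $|\mathcal{G}|>1$ such that $$\sum_{S\in\mathcal{F}}\log|\mathcal{G}(S)|\leq\frac{|\mathcal{F}|\log|\mathcal{G}|}{2}.$$
   Context: All logarithms are base $2$. For a set $S\subseteq[n]$ and a family $\mathcal{G}\subseteq 2^{[n]}$, $\mathcal{G}(S)$ denotes the family $\{S\cup G : G\in\mathcal{G}\}$ (as a set of sets, so $|\mathcal{G}(S)|$ counts distinct sets of this form). -}

module Defs where

open import Data.Nat using (ℕ; _*_; _^_; _≤_; _<_)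
open import Data.Bool using (Bool)
import Data.Bool as B
open import Data.Fin using (Fin)
open import Data.Fin.Subset using (Subset; _∪_; _∈_)
open import Data.Fin.Subset.Properties using (_∈?_)
open import Data.List using (List; length; map; filter; deduplicate)
open import Data.Nat.ListAction using (product)
open import Data.List.Relation.Unary.Unique.Propositional using (Unique)
open import Data.Vec.Properties using (≡-dec)
open import Relation.Binary.PropositionalEquality using (_≡_)
open import Relation.Binary.Definitions using (DecidableEquality)

record Family (n : ℕ) : Set where
  constructor family
  field
    sets   : List (Subset n)
    unique : Unique sets
open Family public

_≟ₛ_ : ∀ {n} → DecidableEquality (Subset n)
_≟ₛ_ = ≡-dec B._≟_

∣_∣ᶠ : ∀ {n} → Family n → ℕ
∣ 𝓕 ∣ᶠ = length (sets 𝓕)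

countContaining : ∀ {n} → Fin n → Family n → ℕ
countContaining i 𝓕 = length (filter (i ∈?_) (sets 𝓕))

-- |𝓖(S)| : number of DISTINCT sets of the form S ∪ G, G ∈ 𝓖
∣_⟨_⟩∣ : ∀ {n} → Family n → Subset n → ℕ
∣ 𝓖 ⟨ S ⟩∣ = length (deduplicate _≟ₛ_ (map (S ∪_) (sets 𝓖)))

-- Σ_{S∈𝓕} log|𝓖(S)| ≤ |𝓕| log|𝓖| / 2, with log base 2, written
-- (after multiplying by 2 and exponentiating) as
-- ∏_{S∈𝓕} |𝓖(S)|^2 ≤ |𝓖|^{|𝓕|}.
LogIneq : ∀ {n} → Family n → Family n → Set
LogIneq 𝓕 𝓖 = product (map (λ S → ∣ 𝓖 ⟨ S ⟩∣ ^ 2) (sets 𝓕)) ≤ ∣ 𝓖 ∣ᶠ ^ ∣ 𝓕 ∣ᶠ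

-- If some i lies in at least half of the sets of 𝓕, then 𝓖 = {∅, {i}} works: |𝓖(S)| is 1 when i ∈ S and 2
-- otherwise.  Conversely, S ∪ G is determined by the part of G outside S, so |𝓖(S)| is the size of the projection
-- of 𝓖 onto the complement of S, and Shearer's lemma gives |𝓖|^t ≤ ∏_{S ∈ 𝓕} |𝓖(S)| whenever every i lies outside
-- at least t members of 𝓕.  If no i lies in half of the sets, t = ⌊|𝓕|/2⌋ + 1 qualifies, and the inequality would
-- give |𝓖|^(2t) ≤ |𝓖|^|𝓕| < |𝓖|^(2t).  Shearer's lemma is proved by induction on n, splitting 𝓖 by the first
-- coordinate; the induction step is Hölder's inequality (∏ xᵢ)^(1/t) + (∏ yᵢ)^(1/t) ≤ (∏ (xᵢ + yᵢ))^(1/t), which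
-- follows from AM–GM.  Everything stays in ℕ by comparing t-th powers instead of taking roots.

module Submission where

open import Defs
open import Data.Nat using (ℕ; suc; _*_; _≥_; _<_)
open import Data.Fin using (Fin)
open import Data.Product using (∃-syntax; _×_)
open import Function.Bundles using (_⇔_)

open import Data.Bool using (Bool; true; false; _∨_)
import Data.Bool as Bool
open import Data.Bool.Properties using (∨-identityʳ)
open import Data.Fin using (zero; suc)
open import Data.Fin.Properties using (any?)
open import Data.Fin.Subset using (Subset; _∪_; _∉_; ⊥; ⁅_⁆) renaming (_∈_ to _∈ₛ_)
open import Data.Fin.Subset.Properties using (_∈?_; ∪-identityʳ; ∉⊥; x∈⁅x⁆)
open import Data.List using (List; []; _∷_; _++_; length; map; filter; deduplicate)
open import Data.List.Properties using (length-map; length-++; map-∘; length-deduplicate)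
open import Data.List.Membership.Propositional using (_∈_)
open import Data.List.Membership.Propositional.Properties
  using (∈-∃++; ∈-++⁻; ∈-++⁺ˡ; ∈-++⁺ʳ; ∈-map⁺; ∈-map⁻; ∈-deduplicate⁺; ∈-deduplicate⁻)
open import Data.List.Relation.Binary.Subset.Propositional using (_⊆_)
open import Data.List.Relation.Unary.All using (All; []; _∷_)
import Data.List.Relation.Unary.All as All
open import Data.List.Relation.Unary.AllPairs using ([]; _∷_)
open import Data.List.Relation.Unary.Any using (here; there)
open import Data.List.Relation.Unary.Unique.Propositional using (Unique)
import Data.List.Relation.Unary.Unique.Propositional.Properties as Unique
open import Data.List.Relation.Unary.Unique.DecPropositional.Properties using (deduplicate-!)
open import Data.Nat
open import Data.Nat.ListAction using (sum; product)
open import Data.Nat.Properties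
open import Algebra.Properties.CommutativeSemigroup *-commutativeSemigroup using (interchange; x∙yz≈y∙xz)
open import Data.Nat.Tactic.RingSolver using (solve-∀)
open import Data.Product using (_,_; proj₁; proj₂)
open import Data.Sum using (inj₁; inj₂; [_,_]′)
open import Data.Vec using ([]; _∷_; tail; here; there)
open import Data.Vec.Properties using (∷-injectiveʳ)
open import Function using (_∘_)
open import Function.Bundles using (mk⇔)
open import Relation.Binary.PropositionalEquality
open import Relation.Nullary using (¬_; contradiction; yes; no)
open import Relation.Unary using (Pred; Decidable)
open import Relation.Unary.Properties using (∁?)

^-distribʳ-* : ∀ m n o → (m * n) ^ o ≡ m ^ o * n ^ o
^-distribʳ-* m n zero    = refl
^-distribʳ-* m n (suc o) =
  trans (cong (m * n *_) (^-distribʳ-* m n o)) (interchange m n (m ^ o) (n ^ o))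

^-cancelʳ-< : ∀ o {m n} → m ^ o < n ^ o → m < n
^-cancelʳ-< o mᵒ<nᵒ = ≰⇒> (λ n≤m → <⇒≱ mᵒ<nᵒ (^-monoˡ-≤ o n≤m))

^-cancelˡ-≤ : ∀ m → 1 < m → ∀ {o p} → m ^ o ≤ m ^ p → o ≤ p
^-cancelˡ-≤ m 1<m mᵒ≤mᵖ = ≮⇒≥ (λ p<o → <⇒≱ (^-monoʳ-< m 1<m p<o) mᵒ≤mᵖ)

n^n≢0 : ∀ n → NonZero (n ^ n)
n^n≢0 zero        = _
n^n≢0 n@(suc _)   = m^n≢0 n n

⌊m+n/2⌋<n : ∀ {m n} → m < n → ⌊ m + n /2⌋ < n
⌊m+n/2⌋<n {zero}  {suc n} _           = ⌊n/2⌋<n n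
⌊m+n/2⌋<n {suc m} {suc n} (s<s m<n) rewrite +-suc m n = s<s (⌊m+n/2⌋<n m<n)

2*m<m+n⇒⌊m+n/2⌋<n : ∀ m n → 2 * m < m + n → ⌊ m + n /2⌋ < n
2*m<m+n⇒⌊m+n/2⌋<n m n 2m<m+n =
  ⌊m+n/2⌋<n (+-cancelˡ-< m m n (subst (_< m + n) (cong (m +_) (+-identityʳ m)) 2m<m+n))

m<[1+⌊m/2⌋]*2 : ∀ m → m < suc ⌊ m /2⌋ * 2
m<[1+⌊m/2⌋]*2 zero          = z<s
m<[1+⌊m/2⌋]*2 (suc zero)    = s<s z<s
m<[1+⌊m/2⌋]*2 (suc (suc m)) = s<s (s<s (m<[1+⌊m/2⌋]*2 m))

m+n≤2*m⇒2*n≤m+n : ∀ m n → m + n ≤ 2 * m → 2 * n ≤ m + n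
m+n≤2*m⇒2*n≤m+n m n m+n≤2m = begin
  2 * n  ≡⟨ cong (n +_) (+-identityʳ n) ⟩
  n + n  ≤⟨ +-monoˡ-≤ n n≤m ⟩
  m + n  ∎
  where
  open ≤-Reasoning
  n≤m : n ≤ m
  n≤m = +-cancelˡ-≤ m n m (subst (m + n ≤_) (cong (m +_) (+-identityʳ m)) m+n≤2m)

product-map-* : ∀ c ns → product (map (c *_) ns) ≡ c ^ length ns * product ns
product-map-* c []       = refl
product-map-* c (n ∷ ns) =
  trans (cong (c * n *_) (product-map-* c ns)) (interchange c n (c ^ length ns) (product ns))

sum-map-* : ∀ c ns → sum (map (c *_) ns) ≡ c * sum ns
sum-map-* c []       = sym (*-zeroʳ c)
sum-map-* c (n ∷ ns) = trans (cong (c * n +_) (sum-map-* c ns)) (sym (*-distribˡ-+ c n (sum ns)))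

product-map-^ : ∀ {a} {A : Set a} (f : A → ℕ) k es → product (map (λ e → f e ^ k) es) ≡ product (map f es) ^ k
product-map-^ f k []       = sym (^-zeroˡ k)
product-map-^ f k (e ∷ es) =
  trans (cong (f e ^ k *_) (product-map-^ f k es)) (sym (^-distribʳ-* (f e) (product (map f es)) k))

product-map-pos : ∀ {a} {A : Set a} (f : A → ℕ) → (∀ e → 0 < f e) → ∀ es → 0 < product (map f es)
product-map-pos f f>0 []       = z<s
product-map-pos f f>0 (e ∷ es) = *-mono-≤ (f>0 e) (product-map-pos f f>0 es)

length-filter+length-filter-∁ : ∀ {a ℓ} {A : Set a} {P : Pred A ℓ} (P? : Decidable P) xs →
                                length (filter P? xs) + length (filter (∁? P?) xs) ≡ length xs
length-filter+length-filter-∁ P? []       = refl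
length-filter+length-filter-∁ P? (x ∷ xs) with P? x
... | yes _ = cong suc (length-filter+length-filter-∁ P? xs)
... | no  _ = trans (+-suc _ _) (cong suc (length-filter+length-filter-∁ P? xs))

unique-⊆⇒length≤ : ∀ {a} {A : Set a} {xs ys : List A} → Unique xs → xs ⊆ ys → length xs ≤ length ys
unique-⊆⇒length≤ {xs = []}    _              _     = z≤n
unique-⊆⇒length≤ {xs = x ∷ xs} (x∉xs ∷ !xs) xs⊆ys
  with ys₁ , ys₂ , refl ← ∈-∃++ (xs⊆ys (here refl)) = begin
  suc (length xs)                  ≤⟨ s≤s (unique-⊆⇒length≤ !xs xs⊆ys₁++ys₂) ⟩
  suc (length (ys₁ ++ ys₂))        ≡⟨ cong suc (length-++ ys₁) ⟩
  suc (length ys₁ + length ys₂)    ≡⟨ sym (+-suc (length ys₁) (length ys₂)) ⟩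
  length ys₁ + length (x ∷ ys₂)    ≡⟨ sym (length-++ ys₁) ⟩
  length (ys₁ ++ x ∷ ys₂)          ∎
  where
  open ≤-Reasoning
  xs⊆ys₁++ys₂ : xs ⊆ ys₁ ++ ys₂
  xs⊆ys₁++ys₂ z∈xs with ∈-++⁻ ys₁ (xs⊆ys (there z∈xs))
  ... | inj₁ z∈ys₁         = ∈-++⁺ˡ z∈ys₁
  ... | inj₂ (here refl)   = contradiction refl (All.lookup x∉xs z∈xs)
  ... | inj₂ (there z∈ys₂) = ∈-++⁺ʳ ys₁ z∈ys₂

-- AM–GM inequality

rearrangement : ∀ {x y a b} → x ≤ y → a ≤ b → x * b + y * a ≤ x * a + y * b
rearrangement {x} {y} {a} {b} x≤y a≤b
  with d , refl ← m≤n⇒∃[o]m+o≡n x≤y | e , refl ← m≤n⇒∃[o]m+o≡n a≤b =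
  ≤-trans (m≤m+n _ (d * e)) (≤-reflexive (expand x a d e))
  where
  expand : ∀ x a d e → x * (a + e) + (x + d) * a + d * e ≡ x * a + (x + d) * (a + e)
  expand = solve-∀

^-rearrangement : ∀ k x y → x * y ^ k + y * x ^ k ≤ x ^ suc k + y ^ suc k
^-rearrangement k x y with ≤-total x y
... | inj₁ x≤y = rearrangement x≤y (^-monoˡ-≤ k x≤y)
... | inj₂ y≤x = subst₂ _≤_ (+-comm (y * x ^ k) (x * y ^ k)) (+-comm (y * y ^ k) (x * x ^ k))
                   (rearrangement y≤x (^-monoˡ-≤ k y≤x))

-- The graph of c ↦ c ^ (k + 1) lies above its tangent line at b.
^-tangent : ∀ k b c → suc k * c * b ^ k ≤ c ^ suc k + k * b ^ suc k
^-tangent zero    b c = ≤-reflexive (base b c)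
  where
  base : ∀ b c → 1 * c * 1 ≡ c * 1 + 0 * (b * 1)
  base = solve-∀
^-tangent (suc k) b c = begin
  suc (suc k) * c * b ^ suc k                        ≡⟨ peel k b c (b ^ k) ⟩
  c * b ^ suc k + b * (suc k * c * b ^ k)            ≤⟨ +-monoʳ-≤ _ (*-monoʳ-≤ b (^-tangent k b c)) ⟩
  c * b ^ suc k + b * (c ^ suc k + k * b ^ suc k)    ≡⟨ regroup k b c (b ^ k) (c ^ suc k) ⟩
  c * b ^ suc k + b * c ^ suc k + k * b ^ suc (suc k) ≤⟨ +-monoˡ-≤ _ (^-rearrangement (suc k) c b) ⟩
  c ^ suc (suc k) + b ^ suc (suc k) + k * b ^ suc (suc k) ≡⟨ +-assoc (c ^ suc (suc k)) _ _ ⟩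
  c ^ suc (suc k) + suc k * b ^ suc (suc k)          ∎
  where
  open ≤-Reasoning
  peel : ∀ k b c B → suc (suc k) * c * (b * B) ≡ c * (b * B) + b * (suc k * c * B)
  peel = solve-∀
  regroup : ∀ k b c B C → c * (b * B) + b * (C + k * (b * B)) ≡ c * (b * B) + b * C + k * (b * (b * B))
  regroup = solve-∀

-- z * (s / k) ^ k ≤ ((z + s) / (k + 1)) ^ (k + 1): AM–GM for z and k copies of s / k.
amgm-step : ∀ k s z → suc k ^ suc k * z * s ^ k ≤ k ^ k * (z + s) ^ suc k
amgm-step zero      s z = subst₂ _≤_ (unitˡ z) (unitʳ z s) (m≤m+n z s)
  where
  unitˡ : ∀ z → z ≡ 1 * z * 1
  unitˡ = solve-∀
  unitʳ : ∀ z s → z + s ≡ 1 * ((z + s) * 1)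
  unitʳ = solve-∀
amgm-step k@(suc _) s z = *-cancelˡ-≤ k (begin
  k * (suc k ^ suc k * z * s ^ k)          ≡⟨ regroup k (suc k ^ k) z (s ^ k) ⟩
  suc k * (k * z) * (suc k ^ k * s ^ k)    ≡⟨ cong (suc k * (k * z) *_) (sym (^-distribʳ-* (suc k) s k)) ⟩
  suc k * (k * z) * b ^ k                  ≤⟨ below-tangent ⟩
  c ^ suc k                                ≡⟨ ^-distribʳ-* k (z + s) (suc k) ⟩
  k ^ suc k * (z + s) ^ suc k              ≡⟨ *-assoc k (k ^ k) _ ⟩
  k * (k ^ k * (z + s) ^ suc k)            ∎)
  where
  open ≤-Reasoning
  b = suc k * s
  c = k * (z + s)
  regroup : ∀ k P z Q → k * (suc k * P * z * Q) ≡ suc k * (k * z) * (P * Q)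
  regroup = solve-∀
  split : ∀ k z s B → suc k * (k * (z + s)) * B ≡ suc k * (k * z) * B + k * (suc k * s * B)
  split = solve-∀
  below-tangent : suc k * (k * z) * b ^ k ≤ c ^ suc k
  below-tangent = +-cancelʳ-≤ (k * b ^ suc k) _ _
    (subst (_≤ c ^ suc k + k * b ^ suc k) (split k z s (b ^ k)) (^-tangent k b c))

amgm : ∀ u → length u ^ length u * product u ≤ sum u ^ length u
amgm []      = ≤-refl
amgm (z ∷ w) = *-cancelˡ-≤ (k ^ k) {{n^n≢0 k}} (begin
  k ^ k * (suc k ^ suc k * (z * product w))   ≡⟨ regroup (k ^ k) (suc k ^ suc k) z (product w) ⟩
  suc k ^ suc k * z * (k ^ k * product w)     ≤⟨ *-monoʳ-≤ (suc k ^ suc k * z) (amgm w) ⟩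
  suc k ^ suc k * z * sum w ^ k               ≤⟨ amgm-step k (sum w) z ⟩
  k ^ k * (z + sum w) ^ suc k                 ∎)
  where
  open ≤-Reasoning
  k = length w
  regroup : ∀ K L z p → K * (L * (z * p)) ≡ L * z * (K * p)
  regroup = solve-∀

-- Hölder's inequality

total : ℕ × ℕ → ℕ
total (x , y) = x + y

∏ : (ℕ × ℕ → ℕ) → List (ℕ × ℕ) → ℕ
∏ f ps = product (map f ps)

∏-mono-≤ : ∀ {f g} → (∀ p → f p ≤ g p) → ∀ ps → ∏ f ps ≤ ∏ g ps
∏-mono-≤ f≤g []       = ≤-refl
∏-mono-≤ f≤g (p ∷ ps) = *-mono-≤ (f≤g p) (∏-mono-≤ f≤g ps)

-- The i-th share is f pᵢ * ∏_{j ≠ i} total pⱼ, i.e. the fraction f pᵢ / total pᵢ of ∏ total ps.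
shares : (ℕ × ℕ → ℕ) → List (ℕ × ℕ) → List ℕ
shares f []       = []
shares f (p ∷ ps) = f p * ∏ total ps ∷ map (total p *_) (shares f ps)

length-shares : ∀ f ps → length (shares f ps) ≡ length ps
length-shares f []       = refl
length-shares f (p ∷ ps) = cong suc (trans (length-map _ (shares f ps)) (length-shares f ps))

product-shares : ∀ f ps → product (shares f ps) * ∏ total ps ≡ ∏ f ps * ∏ total ps ^ length ps
product-shares f []       = refl
product-shares f (p ∷ ps) = begin
  f p * π * product (map (c *_) (shares f ps)) * (c * π)
    ≡⟨ cong (λ q → f p * π * q * (c * π)) (product-map-* c (shares f ps)) ⟩
  f p * π * (c ^ length (shares f ps) * product (shares f ps)) * (c * π)
    ≡⟨ cong (λ k → f p * π * (c ^ k * product (shares f ps)) * (c * π)) (length-shares f ps) ⟩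
  f p * π * (c ^ t * product (shares f ps)) * (c * π)
    ≡⟨ regroup₁ (f p) π c (c ^ t) (product (shares f ps)) ⟩
  f p * π * c * c ^ t * (product (shares f ps) * π)
    ≡⟨ cong (f p * π * c * c ^ t *_) (product-shares f ps) ⟩
  f p * π * c * c ^ t * (∏ f ps * π ^ t)
    ≡⟨ regroup₂ (f p) π c (c ^ t) (∏ f ps) (π ^ t) ⟩
  f p * ∏ f ps * (c * π * (c ^ t * π ^ t))
    ≡⟨ cong (λ q → f p * ∏ f ps * (c * π * q)) (sym (^-distribʳ-* c π t)) ⟩
  f p * ∏ f ps * (c * π * (c * π) ^ t) ∎
  where
  open ≡-Reasoning
  c = total p
  π = ∏ total ps
  t = length ps
  regroup₁ : ∀ x π c C w → x * π * (C * w) * (c * π) ≡ x * π * c * C * (w * π)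
  regroup₁ = solve-∀
  regroup₂ : ∀ x π c C X P → x * π * c * C * (X * P) ≡ x * X * (c * π * (C * P))
  regroup₂ = solve-∀

sum-shares : ∀ ps → sum (shares proj₁ ps) + sum (shares proj₂ ps) ≡ length ps * ∏ total ps
sum-shares []             = refl
sum-shares ((x , y) ∷ ps) = begin
  x * π + sum (map (c *_) U) + (y * π + sum (map (c *_) V))
    ≡⟨ cong₂ (λ u v → x * π + u + (y * π + v)) (sum-map-* c U) (sum-map-* c V) ⟩
  x * π + c * sum U + (y * π + c * sum V)   ≡⟨ regroup x y π (sum U) (sum V) ⟩
  c * π + c * (sum U + sum V)               ≡⟨ cong (λ s → c * π + c * s) (sum-shares ps) ⟩
  c * π + c * (length ps * π)               ≡⟨ collect c π (length ps) ⟩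
  suc (length ps) * (c * π)                 ∎
  where
  open ≡-Reasoning
  c = x + y
  π = ∏ total ps
  U = shares proj₁ ps
  V = shares proj₂ ps
  regroup : ∀ x y π u v → x * π + (x + y) * u + (y * π + (x + y) * v) ≡ (x + y) * π + (x + y) * (u + v)
  regroup = solve-∀
  collect : ∀ c π t → c * π + c * (t * π) ≡ suc t * (c * π)
  collect = solve-∀

share-bound : ∀ f ps {a r} → a ^ length ps ≤ ∏ f ps * r →
              (a * (length ps * ∏ total ps)) ^ length ps ≤ sum (shares f ps) ^ length ps * (∏ total ps * r)
share-bound f ps {a} {r} aᵗ≤ = begin
  (a * (t * π)) ^ t                 ≡⟨ trans (^-distribʳ-* a (t * π) t) (cong (a ^ t *_) (^-distribʳ-* t π t)) ⟩
  a ^ t * (t ^ t * π ^ t)           ≤⟨ *-monoˡ-≤ _ aᵗ≤ ⟩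
  ∏ f ps * r * (t ^ t * π ^ t)      ≡⟨ regroup₁ (∏ f ps) r (t ^ t) (π ^ t) ⟩
  r * t ^ t * (∏ f ps * π ^ t)      ≡⟨ cong (r * t ^ t *_) (sym (product-shares f ps)) ⟩
  r * t ^ t * (product sh * π)      ≡⟨ regroup₂ r (t ^ t) (product sh) π ⟩
  π * r * (t ^ t * product sh)      ≤⟨ *-monoʳ-≤ (π * r) amgm-shares ⟩
  π * r * sum sh ^ t                ≡⟨ *-comm (π * r) _ ⟩
  sum sh ^ t * (π * r)              ∎
  where
  open ≤-Reasoning
  t = length ps
  π = ∏ total ps
  sh = shares f ps
  amgm-shares : t ^ t * product sh ≤ sum sh ^ t
  amgm-shares = subst (λ k → k ^ k * product sh ≤ sum sh ^ k) (length-shares f ps) (amgm sh)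
  regroup₁ : ∀ X r T P → X * r * (T * P) ≡ r * T * (X * P)
  regroup₁ = solve-∀
  regroup₂ : ∀ r T w π → r * T * (w * π) ≡ π * r * (T * w)
  regroup₂ = solve-∀

root-< : ∀ o {x u z w} .{{_ : NonZero u}} → x ^ o ≤ u ^ o * z → z < w ^ o → x < u * w
root-< o {x} {u} {z} {w} xᵒ≤uᵒz z<wᵒ = ^-cancelʳ-< o (begin-strict
  x ^ o          ≤⟨ xᵒ≤uᵒz ⟩
  u ^ o * z      <⟨ *-monoʳ-< (u ^ o) {{m^n≢0 u o}} z<wᵒ ⟩
  u ^ o * w ^ o  ≡⟨ sym (^-distribʳ-* u w o) ⟩
  (u * w) ^ o    ∎)
  where open ≤-Reasoning

root-≤ : ∀ o {x u z w} → x ^ suc o ≤ u ^ suc o * z → z < w ^ suc o → x ≤ u * w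
root-≤ o {x} {zero}  xᵒ≤0   _     = ≤-reflexive (m^n≡0⇒m≡0 x (suc o) (n≤0⇒n≡0 xᵒ≤0))
root-≤ o {u = suc _} xᵒ≤uᵒz z<wᵒ = <⇒≤ (root-< (suc o) xᵒ≤uᵒz z<wᵒ)

-- Read over the reals, the hypotheses say a * T ≤ u * r and b * T ≤ v * r for r = z ^ (1 / suc o); add them.
root-sum : ∀ o {a b u v T z} → 0 < T → u + v ≡ T →
           (a * T) ^ suc o ≤ u ^ suc o * z → (b * T) ^ suc o ≤ v ^ suc o * z → (a + b) ^ suc o ≤ z
root-sum o {a} {b} {u} {v} {T} {z} 0<T u+v≡T ha hb with (a + b) ^ suc o ≤? z
... | yes ok = ok
... | no ¬ok = contradiction (strict u v u+v≡T ha hb) (<-irrefl balance)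
  where
  w = a + b
  z<wᵒ : z < w ^ suc o
  z<wᵒ = ≰⇒> ¬ok
  balance : a * T + b * T ≡ u * w + v * w
  balance = begin
    a * T + b * T  ≡⟨ *-distribʳ-+ T a b ⟨
    w * T          ≡⟨ *-comm w T ⟩
    T * w          ≡⟨ cong (_* w) u+v≡T ⟨
    (u + v) * w    ≡⟨ *-distribʳ-+ w u v ⟩
    u * w + v * w  ∎
    where open ≡-Reasoning
  strict : ∀ u v → u + v ≡ T → (a * T) ^ suc o ≤ u ^ suc o * z → (b * T) ^ suc o ≤ v ^ suc o * z →
           a * T + b * T < u * w + v * w
  strict zero      zero    0≡T _  _  = contradiction (sym 0≡T) (>⇒≢ 0<T)
  strict zero      v@(suc _) _ ha hb =
    +-mono-≤-< (root-≤ o {a * T} {0} {z} {w} ha z<wᵒ) (root-< (suc o) {b * T} {v} {z} {w} hb z<wᵒ)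
  strict u@(suc _) v         _ ha hb =
    +-mono-<-≤ (root-< (suc o) {a * T} {u} {z} {w} ha z<wᵒ) (root-≤ o {b * T} {v} {z} {w} hb z<wᵒ)

holder : ∀ ps {a b r} → 1 ≤ length ps → a ^ length ps ≤ ∏ proj₁ ps * r → b ^ length ps ≤ ∏ proj₂ ps * r →
         (a + b) ^ length ps ≤ ∏ total ps * r
holder ps@(_ ∷ ps′) {a} {b} {r} _ ha hb with ∏ total ps ≟ 0
... | no π≢0 = root-sum (length ps′) {a} {b} {sum (shares proj₁ ps)} {sum (shares proj₂ ps)} 0<T (sum-shares ps)
                 (share-bound proj₁ ps {a} {r} ha) (share-bound proj₂ ps {b} {r} hb)
  where
  0<T : 0 < length ps * ∏ total ps
  0<T = <-≤-trans (n≢0⇒n>0 π≢0) (m≤n*m (∏ total ps) (length ps))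
... | yes π≡0 = subst (λ s → s ^ length ps ≤ ∏ total ps * r)
                  (sym (cong₂ _+_ (vanishes {proj₁} {a} (λ (x , y) → m≤m+n x y) ha)
                                   (vanishes {proj₂} {b} (λ (x , y) → m≤n+m y x) hb))) z≤n
  where
  vanishes : ∀ {f x} → (∀ p → f p ≤ total p) → x ^ length ps ≤ ∏ f ps * r → x ≡ 0
  vanishes {f} {x} f≤total xᵗ≤ = m^n≡0⇒m≡0 x (length ps) (n≤0⇒n≡0 (begin
    x ^ length ps      ≤⟨ xᵗ≤ ⟩
    ∏ f ps * r         ≤⟨ *-monoˡ-≤ r (∏-mono-≤ f≤total ps) ⟩
    ∏ total ps * r     ≡⟨ cong (_* r) π≡0 ⟩
    0                  ∎))
    where open ≤-Reasoning

module _ {a} {A : Set a} (f g h : A → ℕ) where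

  -- t of the entries, kept as pairs (f e , g e); all other entries are absorbed into the common factor rest.
  record Selection (es : List A) (t : ℕ) : Set where
    field
      pairs        : List (ℕ × ℕ)
      length-pairs : length pairs ≡ t
      rest         : ℕ
      f-bound      : product (map f es) ≤ ∏ proj₁ pairs * rest
      g-bound      : product (map g es) ≤ ∏ proj₂ pairs * rest
      h-bound      : ∏ total pairs * rest ≤ product (map h es)

  module _ {ℓ} {C : Pred A ℓ} (C? : Decidable C) (f≤h : ∀ e → f e ≤ h e) (g≤h : ∀ e → g e ≤ h e)
           (f+g≤h : ∀ {e} → C e → f e + g e ≤ h e) where

    skip : ∀ {e es t} → Selection es t → Selection (e ∷ es) t
    skip {e} {es} σ = record
      { pairs        = pairs
      ; length-pairs = length-pairs
      ; rest         = h e * rest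
      ; f-bound      = ≤-trans (*-mono-≤ (f≤h e) f-bound) (≤-reflexive (x∙yz≈y∙xz (h e) (∏ proj₁ pairs) rest))
      ; g-bound      = ≤-trans (*-mono-≤ (g≤h e) g-bound) (≤-reflexive (x∙yz≈y∙xz (h e) (∏ proj₂ pairs) rest))
      ; h-bound      = ≤-trans (≤-reflexive (x∙yz≈y∙xz (∏ total pairs) (h e) rest)) (*-monoʳ-≤ (h e) h-bound)
      }
      where open Selection σ

    take : ∀ {e es t} → C e → Selection es t → Selection (e ∷ es) (suc t)
    take {e} {es} c σ = record
      { pairs        = (f e , g e) ∷ pairs
      ; length-pairs = cong suc length-pairs
      ; rest         = rest
      ; f-bound      = ≤-trans (*-monoʳ-≤ (f e) f-bound) (≤-reflexive (sym (*-assoc (f e) (∏ proj₁ pairs) rest)))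
      ; g-bound      = ≤-trans (*-monoʳ-≤ (g e) g-bound) (≤-reflexive (sym (*-assoc (g e) (∏ proj₂ pairs) rest)))
      ; h-bound      = ≤-trans (≤-reflexive (*-assoc (f e + g e) (∏ total pairs) rest)) (*-mono-≤ (f+g≤h c) h-bound)
      }
      where open Selection σ

    select : ∀ es t → t ≤ length (filter C? es) → Selection es t
    select []       zero    _ = record
      { pairs = [] ; length-pairs = refl ; rest = 1 ; f-bound = ≤-refl ; g-bound = ≤-refl ; h-bound = ≤-refl }
    select (e ∷ es) zero    _ = skip (select es zero z≤n)
    select (e ∷ es) (suc t) t<∣C∣ with C? e
    ... | yes c = take c (select es t (s≤s⁻¹ t<∣C∣))
    ... | no  _ = skip (select es (suc t) t<∣C∣)

    holder-selected : ∀ es {t a b} → 1 ≤ t → t ≤ length (filter C? es) →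
                      a ^ t ≤ product (map f es) → b ^ t ≤ product (map g es) → (a + b) ^ t ≤ product (map h es)
    holder-selected es {t} {a} {b} 1≤t t≤∣C∣ ha hb with select es t t≤∣C∣
    ... | record { pairs = ps ; length-pairs = refl ; rest = r ; f-bound = f≤ ; g-bound = g≤ ; h-bound = h≥ } =
      ≤-trans (holder ps {a} {b} {r} 1≤t (≤-trans ha f≤) (≤-trans hb g≤)) h≥

-- Shearer's lemma

tails-with : ∀ {n} → Bool → List (Subset (suc n)) → List (Subset n)
tails-with b []             = []
tails-with b ((c ∷ v) ∷ Gs) with c Bool.≟ b
... | yes _ = v ∷ tails-with b Gs
... | no  _ = tails-with b Gs

∈-tails-with⁻ : ∀ {n} b (Gs : List (Subset (suc n))) {v} → v ∈ tails-with b Gs → (b ∷ v) ∈ Gs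
∈-tails-with⁻ b ((c ∷ w) ∷ Gs) v∈ with c Bool.≟ b | v∈
... | yes refl | here refl = here refl
... | yes refl | there v∈′ = there (∈-tails-with⁻ b Gs v∈′)
... | no  _    | v∈′       = there (∈-tails-with⁻ b Gs v∈′)

All-tails-with : ∀ {n ℓ} {P : Pred (Subset (suc n)) ℓ} b {Gs} → All P Gs → All (P ∘ (b ∷_)) (tails-with b Gs)
All-tails-with b []                      = []
All-tails-with b {(c ∷ w) ∷ Gs} (p ∷ ps) with c Bool.≟ b
... | yes refl = p ∷ All-tails-with b ps
... | no  _    = All-tails-with b ps

tails-with-unique : ∀ {n} b {Gs : List (Subset (suc n))} → Unique Gs → Unique (tails-with b Gs)
tails-with-unique b []                             = []
tails-with-unique b {(c ∷ w) ∷ Gs} (w∉Gs ∷ !Gs) with c Bool.≟ b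
... | yes refl = All.map (λ ≢ → ≢ ∘ cong (b ∷_)) (All-tails-with b w∉Gs) ∷ tails-with-unique b !Gs
... | no  _    = tails-with-unique b !Gs

length-tails-with : ∀ {n} (Gs : List (Subset (suc n))) →
                    length Gs ≡ length (tails-with false Gs) + length (tails-with true Gs)
length-tails-with []                 = refl
length-tails-with ((false ∷ v) ∷ Gs) = cong suc (length-tails-with Gs)
length-tails-with ((true ∷ v) ∷ Gs)  = trans (cong suc (length-tails-with Gs)) (sym (+-suc _ _))

slice : ∀ {n} → Bool → Family (suc n) → Family n
slice b 𝓖 = family (tails-with b (sets 𝓖)) (tails-with-unique b (unique 𝓖))

∣⟨⟩∣-lower-bound : ∀ {n} (𝓖 : Family n) {S xs} → Unique xs → xs ⊆ map (S ∪_) (sets 𝓖) →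
                   length xs ≤ ∣ 𝓖 ⟨ S ⟩∣
∣⟨⟩∣-lower-bound 𝓖 !xs xs⊆ = unique-⊆⇒length≤ !xs (∈-deduplicate⁺ _≟ₛ_ ∘ xs⊆)

module _ {n} (𝓖 : Family (suc n)) (S : Subset n) where

  -- Since (b ∷ S) ∪ (c ∷ v) ≡ (b ∨ c) ∷ (S ∪ v), these are distinct members of 𝓖(b ∷ S).
  lifted : Bool → Bool → List (Subset (suc n))
  lifted b c = map ((b ∨ c) ∷_) (deduplicate _≟ₛ_ (map (S ∪_) (sets (slice c 𝓖))))

  lifted-unique : ∀ b c → Unique (lifted b c)
  lifted-unique b c = Unique.map⁺ ∷-injectiveʳ (deduplicate-! _≟ₛ_ _)

  lifted-⊆ : ∀ b c → lifted b c ⊆ map ((b ∷ S) ∪_) (sets 𝓖)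
  lifted-⊆ b c z∈
    with w , w∈ , refl ← ∈-map⁻ _ z∈
    with v , v∈ , refl ← ∈-map⁻ _ (∈-deduplicate⁻ _≟ₛ_ _ w∈) =
    ∈-map⁺ ((b ∷ S) ∪_) (∈-tails-with⁻ c (sets 𝓖) v∈)

  length-lifted : ∀ b c → length (lifted b c) ≡ ∣ slice c 𝓖 ⟨ S ⟩∣
  length-lifted b c = length-map ((b ∨ c) ∷_) (deduplicate _≟ₛ_ (map (S ∪_) (sets (slice c 𝓖))))

  ∣slice⟨⟩∣≤ : ∀ b c → ∣ slice c 𝓖 ⟨ S ⟩∣ ≤ ∣ 𝓖 ⟨ b ∷ S ⟩∣
  ∣slice⟨⟩∣≤ b c = subst (_≤ ∣ 𝓖 ⟨ b ∷ S ⟩∣) (length-lifted b c)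
                          (∣⟨⟩∣-lower-bound 𝓖 (lifted-unique b c) (lifted-⊆ b c))

  ∣slices⟨⟩∣≤ : ∣ slice false 𝓖 ⟨ S ⟩∣ + ∣ slice true 𝓖 ⟨ S ⟩∣ ≤ ∣ 𝓖 ⟨ false ∷ S ⟩∣
  ∣slices⟨⟩∣≤ = subst (_≤ ∣ 𝓖 ⟨ false ∷ S ⟩∣) length-both
    (∣⟨⟩∣-lower-bound 𝓖 (Unique.++⁺ (lifted-unique false false) (lifted-unique false true) disjoint)
                        (λ z∈ → [ lifted-⊆ false false , lifted-⊆ false true ]′ (∈-++⁻ (lifted false false) z∈)))
    where
    length-both : length (lifted false false ++ lifted false true) ≡
                  ∣ slice false 𝓖 ⟨ S ⟩∣ + ∣ slice true 𝓖 ⟨ S ⟩∣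
    length-both = trans (length-++ (lifted false false))
                        (cong₂ _+_ (length-lifted false false) (length-lifted false true))
    disjoint : ∀ {z} → ¬ (z ∈ lifted false false × z ∈ lifted false true)
    disjoint (z∈₀ , z∈₁) with _ , _ , refl ← ∈-map⁻ _ z∈₀ with _ , _ , () ← ∈-map⁻ _ z∈₁

missing : ∀ {n} → Fin n → List (Subset n) → ℕ
missing i Ss = length (filter (∁? (i ∈?_)) Ss)

missing-tail : ∀ {n} (i : Fin n) Ss → missing i (map tail Ss) ≡ missing (suc i) Ss
missing-tail i []             = refl
missing-tail i ((b ∷ S) ∷ Ss) with i ∈? S
... | yes _ = missing-tail i Ss
... | no  _ = cong suc (missing-tail i Ss)

shearer : ∀ {n t} → 1 ≤ t → (𝓖 : Family n) (Ss : List (Subset n)) →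
          (∀ i → t ≤ missing i Ss) → ∣ 𝓖 ∣ᶠ ^ t ≤ product (map ∣ 𝓖 ⟨_⟩∣ Ss)
shearer {zero} {suc t} _ (family []             _) Ss _ = z≤n
shearer {zero} {suc t} _ 𝓖@(family ([] ∷ []) _) Ss _ =
  subst (_≤ product (map ∣ 𝓖 ⟨_⟩∣ Ss)) (sym (^-zeroˡ (suc t)))
        (product-map-pos ∣ 𝓖 ⟨_⟩∣ (λ _ → z<s) Ss)
shearer {zero}         _ (family ([] ∷ [] ∷ _) ((≢ ∷ _) ∷ _)) _ _ = contradiction refl ≢
shearer {suc n} {t} 1≤t 𝓖 Ss t≤missing =
  subst (λ g → g ^ t ≤ product (map ∣ 𝓖 ⟨_⟩∣ Ss)) (sym (length-tails-with (sets 𝓖)))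
    (holder-selected (part false) (part true) ∣ 𝓖 ⟨_⟩∣ (∁? (zero ∈?_)) part≤ part≤ parts≤
                     Ss 1≤t (t≤missing zero) (induction false) (induction true))
  where
  part : Bool → Subset (suc n) → ℕ
  part c S = ∣ slice c 𝓖 ⟨ tail S ⟩∣
  part≤ : ∀ {c} S → part c S ≤ ∣ 𝓖 ⟨ S ⟩∣
  part≤ {c} (b ∷ S) = ∣slice⟨⟩∣≤ 𝓖 S b c
  parts≤ : ∀ {S} → zero ∉ S → part false S + part true S ≤ ∣ 𝓖 ⟨ S ⟩∣
  parts≤ {false ∷ S} _   = ∣slices⟨⟩∣≤ 𝓖 S
  parts≤ {true ∷ S}  0∉S = contradiction here 0∉S
  induction : ∀ c → ∣ slice c 𝓖 ∣ᶠ ^ t ≤ product (map (part c) Ss)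
  induction c = subst (∣ slice c 𝓖 ∣ᶠ ^ t ≤_) (cong product (sym (map-∘ Ss)))
    (shearer 1≤t (slice c 𝓖) (map tail Ss) (λ i → subst (t ≤_) (sym (missing-tail i Ss)) (t≤missing (suc i))))

countContaining+missing : ∀ {n} i (𝓕 : Family n) → countContaining i 𝓕 + missing i (sets 𝓕) ≡ ∣ 𝓕 ∣ᶠ
countContaining+missing i 𝓕 = length-filter+length-filter-∁ (i ∈?_) (sets 𝓕)

x∈p⇒p∪⁅x⁆≡p : ∀ {n} {x : Fin n} {p} → x ∈ₛ p → p ∪ ⁅ x ⁆ ≡ p
x∈p⇒p∪⁅x⁆≡p {p = _ ∷ p} here        = cong (true ∷_) (∪-identityʳ p)
x∈p⇒p∪⁅x⁆≡p {p = b ∷ _} (there x∈p) = cong₂ _∷_ (∨-identityʳ b) (x∈p⇒p∪⁅x⁆≡p x∈p)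

module _ {n} (i : Fin n) where

  emptyAndSingleton : Family n
  emptyAndSingleton = family (⊥ ∷ ⁅ i ⁆ ∷ []) ((⊥≢⁅i⁆ ∷ []) ∷ [] ∷ [])
    where
    ⊥≢⁅i⁆ : ⊥ ≢ ⁅ i ⁆
    ⊥≢⁅i⁆ ⊥≡⁅i⁆ = ∉⊥ (subst (i ∈ₛ_) (sym ⊥≡⁅i⁆) (x∈⁅x⁆ i))

  ∣emptyAndSingleton⟨⟩∣≡1 : ∀ {S} → i ∈ₛ S → ∣ emptyAndSingleton ⟨ S ⟩∣ ≡ 1
  ∣emptyAndSingleton⟨⟩∣≡1 {S} i∈S rewrite ∪-identityʳ S | x∈p⇒p∪⁅x⁆≡p i∈S with S ≟ₛ S
  ... | yes _   = refl
  ... | no  S≢S = contradiction refl S≢S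

  ∏∣emptyAndSingleton⟨⟩∣²≤4^missing : ∀ Ss →
    product (map (λ S → ∣ emptyAndSingleton ⟨ S ⟩∣ ^ 2) Ss) ≤ 4 ^ missing i Ss
  ∏∣emptyAndSingleton⟨⟩∣²≤4^missing []       = ≤-refl
  ∏∣emptyAndSingleton⟨⟩∣²≤4^missing (S ∷ Ss) with i ∈? S
  ... | yes i∈S = begin
    ∣ emptyAndSingleton ⟨ S ⟩∣ ^ 2 * P  ≡⟨ cong (λ k → k ^ 2 * P) (∣emptyAndSingleton⟨⟩∣≡1 i∈S) ⟩
    1 * P                               ≡⟨ *-identityˡ P ⟩
    P                                   ≤⟨ ∏∣emptyAndSingleton⟨⟩∣²≤4^missing Ss ⟩
    4 ^ missing i Ss                    ∎
    where
    open ≤-Reasoning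
    P = product (map (λ S → ∣ emptyAndSingleton ⟨ S ⟩∣ ^ 2) Ss)
  ... | no  _   = *-mono-≤ (^-monoˡ-≤ 2 (length-deduplicate _≟ₛ_ (map (S ∪_) (sets emptyAndSingleton))))
                           (∏∣emptyAndSingleton⟨⟩∣²≤4^missing Ss)

  majority⇒LogIneq : ∀ 𝓕 → ∣ 𝓕 ∣ᶠ ≤ 2 * countContaining i 𝓕 → LogIneq 𝓕 emptyAndSingleton
  majority⇒LogIneq 𝓕 majority = begin
    product (map (λ S → ∣ emptyAndSingleton ⟨ S ⟩∣ ^ 2) (sets 𝓕)) ≤⟨ ∏∣emptyAndSingleton⟨⟩∣²≤4^missing (sets 𝓕) ⟩
    4 ^ d                                                        ≡⟨ ^-*-assoc 2 2 d ⟩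
    2 ^ (2 * d)                                                  ≤⟨ ^-monoʳ-≤ 2 2d≤m ⟩
    2 ^ ∣ 𝓕 ∣ᶠ                                                   ∎
    where
    open ≤-Reasoning
    c = countContaining i 𝓕
    d = missing i (sets 𝓕)
    c+d≡m = countContaining+missing i 𝓕
    2d≤m : 2 * d ≤ ∣ 𝓕 ∣ᶠ
    2d≤m = subst (2 * d ≤_) c+d≡m (m+n≤2*m⇒2*n≤m+n c d (subst (_≤ 2 * c) (sym c+d≡m) majority))

minority⇒1+⌊∣𝓕∣/2⌋≤missing : ∀ {n} i (𝓕 : Family n) → 2 * countContaining i 𝓕 < ∣ 𝓕 ∣ᶠ →
                               suc ⌊ ∣ 𝓕 ∣ᶠ /2⌋ ≤ missing i (sets 𝓕)
minority⇒1+⌊∣𝓕∣/2⌋≤missing i 𝓕 minority =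
  subst (λ m → suc ⌊ m /2⌋ ≤ d) c+d≡m (2*m<m+n⇒⌊m+n/2⌋<n c d (subst (2 * c <_) (sym c+d≡m) minority))
  where
  c = countContaining i 𝓕
  d = missing i (sets 𝓕)
  c+d≡m = countContaining+missing i 𝓕

LogIneq⇒t*2≤∣𝓕∣ : ∀ {n t} {𝓕 𝓖 : Family n} → 1 ≤ t → (∀ i → t ≤ missing i (sets 𝓕)) →
                  1 < ∣ 𝓖 ∣ᶠ → LogIneq 𝓕 𝓖 → t * 2 ≤ ∣ 𝓕 ∣ᶠ
LogIneq⇒t*2≤∣𝓕∣ {t = t} {𝓕} {𝓖} 1≤t t≤missing 1<g ineq = ^-cancelˡ-≤ g 1<g (begin
  g ^ (t * 2)                                    ≡⟨ sym (^-*-assoc g t 2) ⟩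
  (g ^ t) ^ 2                                    ≤⟨ ^-monoˡ-≤ 2 (shearer 1≤t 𝓖 (sets 𝓕) t≤missing) ⟩
  product (map ∣ 𝓖 ⟨_⟩∣ (sets 𝓕)) ^ 2             ≡⟨ sym (product-map-^ ∣ 𝓖 ⟨_⟩∣ 2 (sets 𝓕)) ⟩
  product (map (λ S → ∣ 𝓖 ⟨ S ⟩∣ ^ 2) (sets 𝓕))  ≤⟨ ineq ⟩
  g ^ ∣ 𝓕 ∣ᶠ                                     ∎)
  where
  open ≤-Reasoning
  g = ∣ 𝓖 ∣ᶠ

theorem1p2 : (n : ℕ) → (𝓕 : Family (suc n)) →
    (∃[ i ] 2 * countContaining i 𝓕 ≥ ∣ 𝓕 ∣ᶠ)
      ⇔ (∃[ 𝓖 ] 1 < ∣ 𝓖 ∣ᶠ × LogIneq 𝓕 𝓖)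
theorem1p2 n 𝓕 = mk⇔ forward backward
  where
  m = ∣ 𝓕 ∣ᶠ
  forward : (∃[ i ] 2 * countContaining i 𝓕 ≥ m) → ∃[ 𝓖 ] 1 < ∣ 𝓖 ∣ᶠ × LogIneq 𝓕 𝓖
  forward (i , majority) = emptyAndSingleton i , s<s z<s , majority⇒LogIneq i 𝓕 majority
  backward : (∃[ 𝓖 ] 1 < ∣ 𝓖 ∣ᶠ × LogIneq 𝓕 𝓖) → ∃[ i ] 2 * countContaining i 𝓕 ≥ m
  backward (𝓖 , 1<g , ineq) with any? (λ i → m ≤? 2 * countContaining i 𝓕)
  ... | yes majority = majority
  ... | no ¬majority  =
    contradiction (LogIneq⇒t*2≤∣𝓕∣ {𝓕 = 𝓕} {𝓖} z<s t≤missing 1<g ineq) (<⇒≱ (m<[1+⌊m/2⌋]*2 m))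
    where
    t≤missing : ∀ i → suc ⌊ m /2⌋ ≤ missing i (sets 𝓕)
    t≤missing i = minority⇒1+⌊∣𝓕∣/2⌋≤missing i 𝓕 (≰⇒> (¬majority ∘ (i ,_)))
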